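{- Let $G$ be a graph on $n$ vertices. (i) If $\gamma'_{\rm SMB}(G)<\infty$, then $\gamma'_{\rm SMB}(G)\le\lceil n/2\rceil$. (ii) If $\gamma_{\rm SMB}(G)<\infty$, then $\gamma_{\rm SMB}(G)\le\lfloor n/2\rfloor$. Moreover, both upper bounds are sharp: for infinitely many $n$ there is a graph on $n$ vertices attaining equality in (i), and for infinitely many $n$ there is a graph on $n$ vertices attaining equality in (ii).
   Context: All graphs are finite and simple; $N_G[v]$ is the closed neighborhood of $v$. The Maker-Breaker domination game on $G$ is played by Dominator and Staller, who alternately play a vertex not played before. Dominator wins if the set of vertices he has played is a dominating set of $G$; Staller wins if she has played all vertices of $N_G[v]$ for some $v\in V(G)$. In the D-game Dominator moves first, in the S-game Staller moves first. $\gamma_{\rm SMB}(G)$ (resp. $\gamma'_{\rm SMB}(G)$) is the smallest integer $k$ such that in the D-game (resp. S-game), under any strategy of Dominator, Staller can win having played at most $k$ vertices; the value is $\infty$ if Staller has no winning strategy. -}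

module Defs where

open import Data.Nat using (ℕ; zero; suc; _<_)
open import Data.Bool using (Bool; true; false)
open import Data.Fin using (Fin)
open import Data.Fin.Subset using (Subset; _∈_; _∉_; _∪_; ⁅_⁆; ⊥)
open import Data.Product using (Σ; ∃; _×_)
open import Data.Sum using (_⊎_)
open import Data.Empty renaming (⊥ to Empty)
open import Relation.Nullary using (¬_)
open import Relation.Binary.PropositionalEquality using (_≡_)

record Graph (n : ℕ) : Set where
  field
    adj    : Fin n → Fin n → Bool
    sym    : ∀ u v → adj u v ≡ adj v u
    irrefl : ∀ v → adj v v ≡ false
open Graph public

InClosedNbhd : ∀ {n} → Graph n → Fin n → Fin n → Set
InClosedNbhd G v u = (u ≡ v) ⊎ (adj G v u ≡ true)

Dominates : ∀ {n} → Graph n → Subset n → Set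
Dominates G D = ∀ v → ∃ λ u → InClosedNbhd G v u × u ∈ D

StallerClaimed : ∀ {n} → Graph n → Subset n → Set
StallerClaimed G S = ∃ λ v → ∀ u → InClosedNbhd G v u → u ∈ S

Free : ∀ {n} → Subset n → Subset n → Fin n → Set
Free D S x = x ∉ D × x ∉ S

-- StallerMove G k D S : position where Dominator played D, Staller played S,
-- Staller is to move, and Staller can force a win playing at most k further
-- vertices, against every strategy of Dominator.
StallerMove : ∀ {n} → Graph n → ℕ → Subset n → Subset n → Set
StallerMove G k D S with k
... | zero  = StallerClaimed G S
... | suc k' = StallerClaimed G S ⊎
     (¬ Dominates G D × ∃ λ x → Free D S x ×
        (StallerClaimed G (S ∪ ⁅ x ⁆) ⊎
          (¬ Dominates G D ×
            ∀ y → Free D (S ∪ ⁅ x ⁆) y →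
              StallerMove G k' (D ∪ ⁅ y ⁆) (S ∪ ⁅ x ⁆))))

DominatorMove : ∀ {n} → Graph n → ℕ → Subset n → Subset n → Set
DominatorMove G k D S = StallerClaimed G S ⊎
  (¬ Dominates G D × ∀ y → Free D S y → StallerMove G k (D ∪ ⁅ y ⁆) S)

StallerWinsD : ∀ {n} → Graph n → ℕ → Set
StallerWinsD G k = DominatorMove G k ⊥ ⊥

StallerWinsS : ∀ {n} → Graph n → ℕ → Set
StallerWinsS G k = StallerMove G k ⊥ ⊥

IsγSMB : ∀ {n} → Graph n → ℕ → Set
IsγSMB G k = StallerWinsD G k × (∀ j → j < k → ¬ StallerWinsD G j)

Isγ'SMB : ∀ {n} → Graph n → ℕ → Set
Isγ'SMB G k = StallerWinsS G k × (∀ j → j < k → ¬ StallerWinsS G j)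

module Submission where

-- Every round of the game uses up two unplayed vertices, so if Staller can win
-- at all she can win within ⌈n/2⌉ moves of the S-game, and within ⌊n/2⌋ once
-- Dominator has made the opening move of the D-game.
-- For sharpness join q to c 0 … c (m - 1) and p i to c j for j ≤ i.  Staller
-- plays c 0 , c 1 , …: each c i threatens to complete N[p i] = {p i , c 0 … c i},
-- so Dominator must take p i, and in the end Staller owns N[q].  Conversely,
-- Dominator's pairing c j ↔ p j guards every closed neighbourhood except N[q],
-- which has m + 1 vertices.  Hence γ'_SMB = m + 1 on these 2m + 1 vertices, and
-- adding an isolated vertex, on which Dominator has to open, gives γ_SMB = m + 1
-- on 2m + 2 vertices.

open import Defs hiding (sym)
open import Data.Bool using (Bool; true; false; _∨_)
open import Data.Bool.Properties using (∨-comm; T-≡)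
open import Data.Empty using (⊥-elim)
open import Data.Fin using (Fin; zero; suc; toℕ; fromℕ<; splitAt; _↑ˡ_; _↑ʳ_)
  renaming (_≤_ to _≤ᶠ_)
open import Data.Fin.Properties
  using (toℕ-injective; toℕ-fromℕ<; toℕ<n; splitAt-↑ˡ; splitAt-↑ʳ; splitAt⁻¹-↑ˡ; splitAt⁻¹-↑ʳ)
  renaming (_≟_ to _≟ᶠ_; _≤?_ to _≤ᶠ?_)
open import Data.Fin.Subset using (Subset; _∈_; _∉_; _∪_; ⁅_⁆; ⊥; ⊤; ∣_∣; _⊆_; inside; outside)
open import Data.Fin.Subset.Properties
  using (x∈p∪q⁻; p⊆p∪q; q⊆p∪q; x∈⁅x⁆; x∈⁅y⁆⇒x≡y; x≢y⇒x∉⁅y⁆; ∣⁅x⁆∣≡1; ∉⊥; ∣⊥∣≡0;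
         drop-there; ∣p∣≤∣x∷p∣; p⊂q⇒∣p∣<∣q∣; ⊆-refl; _∈?_; ∈⊤; ∣⊤∣≡n)
open import Data.Maybe using (Maybe; just; nothing)
open import Data.Maybe.Properties using (just-injective)
open import Data.Nat using (ℕ; zero; suc; _+_; _≤_; _<_; _≥_; z≤n; s≤s; s≤s⁻¹; z<s; ⌊_/2⌋; ⌈_/2⌉)
open import Data.Nat.Properties
open import Data.Nat.Tactic.RingSolver using (solve-∀)
open import Data.Product using (Σ; ∃; _×_; _,_; proj₁; proj₂)
open import Data.Sum using (_⊎_; inj₁; inj₂; [_,_]′)
open import Data.Vec using ([]; _∷_)
open import Function using (_∘_; case_of_)
open import Function.Bundles using (Equivalence)
open import Relation.Nullary using (¬_; yes; no)
open import Relation.Nullary.Decidable using (⌊_⌋; toWitness; fromWitness)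
open import Relation.Binary.PropositionalEquality using (_≡_; _≢_; refl; sym; trans; subst; subst₂; cong)

module _ {n : ℕ} where

  ∉-∪ : ∀ {x : Fin n} {p q} → x ∉ p → x ∉ q → x ∉ p ∪ q
  ∉-∪ {p = p} {q} x∉p x∉q x∈p∪q = [ x∉p , x∉q ]′ (x∈p∪q⁻ p q x∈p∪q)

  ∉-∪⁅⁆ : ∀ {x y : Fin n} {p} → x ∉ p → x ≢ y → x ∉ p ∪ ⁅ y ⁆
  ∉-∪⁅⁆ x∉p x≢y = ∉-∪ x∉p (x≢y⇒x∉⁅y⁆ x≢y)

  x∈p∪⁅x⁆ : ∀ (p : Subset n) x → x ∈ p ∪ ⁅ x ⁆
  x∈p∪⁅x⁆ p x = q⊆p∪q p ⁅ x ⁆ (x∈⁅x⁆ x)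

  ∪-mono-⊆ : ∀ {p p′ q q′ : Subset n} → p ⊆ p′ → q ⊆ q′ → p ∪ q ⊆ p′ ∪ q′
  ∪-mono-⊆ {p} {p′} {q} {q′} p⊆p′ q⊆q′ x∈p∪q with x∈p∪q⁻ p q x∈p∪q
  ... | inj₁ x∈p = p⊆p∪q q′ (p⊆p′ x∈p)
  ... | inj₂ x∈q = q⊆p∪q p′ q′ (q⊆q′ x∈q)

  x∉p⇒∣p∣<n : ∀ {x : Fin n} {p} → x ∉ p → ∣ p ∣ < n
  x∉p⇒∣p∣<n {x} {p} x∉p = subst (∣ p ∣ <_) (∣⊤∣≡n n) (p⊂q⇒∣p∣<∣q∣ ((λ _ → ∈⊤) , x , ∈⊤ , x∉p))

∣p∣<n⇒∃∉ : ∀ {n} (p : Subset n) → ∣ p ∣ < n → ∃ λ x → x ∉ p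
∣p∣<n⇒∃∉ (outside ∷ p) _ = zero , λ ()
∣p∣<n⇒∃∉ (inside ∷ p) (s≤s ∣p∣<n) with ∣p∣<n⇒∃∉ p ∣p∣<n
... | x , x∉p = suc x , x∉p ∘ drop-there

∣p∪q∣≤∣p∣+∣q∣ : ∀ {n} (p q : Subset n) → ∣ p ∪ q ∣ ≤ ∣ p ∣ + ∣ q ∣
∣p∪q∣≤∣p∣+∣q∣ []            []            = z≤n
∣p∪q∣≤∣p∣+∣q∣ (inside ∷ p)  (inside ∷ q)  =
  s≤s (≤-trans (∣p∪q∣≤∣p∣+∣q∣ p q) (+-monoʳ-≤ ∣ p ∣ (n≤1+n ∣ q ∣)))
∣p∪q∣≤∣p∣+∣q∣ (inside ∷ p)  (outside ∷ q) = s≤s (∣p∪q∣≤∣p∣+∣q∣ p q)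
∣p∪q∣≤∣p∣+∣q∣ (outside ∷ p) (inside ∷ q)  =
  ≤-trans (s≤s (∣p∪q∣≤∣p∣+∣q∣ p q)) (≤-reflexive (sym (+-suc ∣ p ∣ ∣ q ∣)))
∣p∪q∣≤∣p∣+∣q∣ (outside ∷ p) (outside ∷ q) = ∣p∪q∣≤∣p∣+∣q∣ p q

∣p∪⁅x⁆∣≤1+∣p∣ : ∀ {n} (p : Subset n) x → ∣ p ∪ ⁅ x ⁆ ∣ ≤ suc ∣ p ∣
∣p∪⁅x⁆∣≤1+∣p∣ p x =
  ≤-trans (∣p∪q∣≤∣p∣+∣q∣ p ⁅ x ⁆) (≤-reflexive (trans (cong (∣ p ∣ +_) (∣⁅x⁆∣≡1 x)) (+-comm ∣ p ∣ 1)))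

k≤∣p∣-of-block : ∀ e {k r} (p : Subset (e + (k + r))) → (∀ i → e ↑ʳ (i ↑ˡ r) ∈ p) → k ≤ ∣ p ∣
k≤∣p∣-of-block zero    {zero}  p             _     = z≤n
k≤∣p∣-of-block zero    {suc k} (inside ∷ p)  block = s≤s (k≤∣p∣-of-block zero p (drop-there ∘ block ∘ suc))
k≤∣p∣-of-block zero    {suc k} (outside ∷ p) block with block zero
... | ()
k≤∣p∣-of-block (suc e) (s ∷ p) block = ≤-trans (k≤∣p∣-of-block e p (drop-there ∘ block)) (∣p∣≤∣x∷p∣ s p)

2+∣p∪q∣≤∣[p∪⁅y⁆]∪[q∪⁅x⁆]∣ : ∀ {n} {p q : Subset n} {x y} → x ∉ p ∪ q → y ∉ p ∪ (q ∪ ⁅ x ⁆) →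
                             2 + ∣ p ∪ q ∣ ≤ ∣ (p ∪ ⁅ y ⁆) ∪ (q ∪ ⁅ x ⁆) ∣
2+∣p∪q∣≤∣[p∪⁅y⁆]∪[q∪⁅x⁆]∣ {p = p} {q} {x} {y} x∉p∪q y∉p∪q′ =
  ≤-trans (s≤s (p⊂q⇒∣p∣<∣q∣ (∪-mono-⊆ ⊆-refl (p⊆p∪q ⁅ x ⁆) , x , q⊆p∪q p _ (x∈p∪⁅x⁆ q x) , x∉p∪q)))
          (p⊂q⇒∣p∣<∣q∣ (∪-mono-⊆ (p⊆p∪q ⁅ y ⁆) ⊆-refl , y , p⊆p∪q (q ∪ ⁅ x ⁆) (x∈p∪⁅x⁆ p y) , y∉p∪q′))

n≤⌈n/2⌉+⌈n/2⌉ : ∀ n → n ≤ ⌈ n /2⌉ + ⌈ n /2⌉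
n≤⌈n/2⌉+⌈n/2⌉ n = subst (_≤ ⌈ n /2⌉ + ⌈ n /2⌉) (⌊n/2⌋+⌈n/2⌉≡n n) (+-monoˡ-≤ ⌈ n /2⌉ (⌊n/2⌋≤⌈n/2⌉ n))

n≤1+⌊n/2⌋+⌊n/2⌋ : ∀ n → n ≤ suc (⌊ n /2⌋ + ⌊ n /2⌋)
n≤1+⌊n/2⌋+⌊n/2⌋ zero          = z≤n
n≤1+⌊n/2⌋+⌊n/2⌋ (suc zero)    = s≤s z≤n
n≤1+⌊n/2⌋+⌊n/2⌋ (suc (suc n)) = s≤s (≤-trans (s≤s (n≤1+⌊n/2⌋+⌊n/2⌋ n)) (≤-reflexive (cong suc (sym (+-suc _ _)))))

minimal-≤ : ∀ {P : ℕ → Set} {k j} → (∀ i → i < k → ¬ P i) → P j → k ≤ j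
minimal-≤ {j = j} minimal Pj = ≮⇒≥ (λ j<k → minimal j j<k Pj)

module Game {n : ℕ} (G : Graph n) where

  Undominated : Subset n → Fin n → Set
  Undominated D v = ∀ {u} → InClosedNbhd G v u → u ∉ D

  undominated⇒¬dominates : ∀ {D v} → Undominated D v → ¬ Dominates G D
  undominated⇒¬dominates {v = v} undominated dominates with dominates v
  ... | _ , u∈N[v] , u∈D = undominated u∈N[v] u∈D

  claimed⇒stallerMove : ∀ k {D S} → StallerClaimed G S → StallerMove G k D S
  claimed⇒stallerMove zero    claimed = claimed
  claimed⇒stallerMove (suc k) claimed = inj₁ claimed

  staller-completes : ∀ {k D S x} v → Free D S x → Undominated D v →
                      (∀ u → InClosedNbhd G v u → u ∈ S ∪ ⁅ x ⁆) → StallerMove G (suc k) D S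
  staller-completes v free undominated claims =
    inj₂ (undominated⇒¬dominates undominated , _ , free , inj₁ (v , claims))

  staller-threatens : ∀ {k D S x v} → Free D S x → Undominated D v →
                      (∀ y → Free D (S ∪ ⁅ x ⁆) y → StallerMove G k (D ∪ ⁅ y ⁆) (S ∪ ⁅ x ⁆)) →
                      StallerMove G (suc k) D S
  staller-threatens {D = D} free undominated next = inj₂ (¬dominates , _ , free , inj₂ (¬dominates , next))
    where
    ¬dominates : ¬ Dominates G D
    ¬dominates = undominated⇒¬dominates undominated

  stallerMove-cap : ∀ k f {D S} → n ≤ ∣ D ∪ S ∣ + (f + f) → StallerMove G k D S → StallerMove G f D S
  stallerMove-cap zero    f _ claimed        = claimed⇒stallerMove f claimed
  stallerMove-cap (suc k) f _ (inj₁ claimed) = claimed⇒stallerMove f claimed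
  stallerMove-cap (suc k) zero n≤ (inj₂ (_ , x , (x∉D , x∉S) , _)) =
    ⊥-elim (<⇒≱ (x∉p⇒∣p∣<n (∉-∪ x∉D x∉S)) (subst (n ≤_) (+-identityʳ _) n≤))
  stallerMove-cap (suc k) (suc f) _ (inj₂ (¬dom , x , free , inj₁ claimed)) =
    inj₂ (¬dom , x , free , inj₁ claimed)
  stallerMove-cap (suc k) (suc f) {D} {S} n≤ (inj₂ (¬dom , x , (x∉D , x∉S) , inj₂ (¬dom′ , next))) =
    inj₂ (¬dom , x , (x∉D , x∉S) , inj₂ (¬dom′ , λ y free → stallerMove-cap k f (n≤′ free) (next y free)))
    where
    arith : ∀ a f → a + (suc f + suc f) ≡ 2 + a + (f + f)
    arith = solve-∀
    n≤′ : ∀ {y} → Free D (S ∪ ⁅ x ⁆) y → n ≤ ∣ (D ∪ ⁅ y ⁆) ∪ (S ∪ ⁅ x ⁆) ∣ + (f + f)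
    n≤′ (y∉D , y∉S′) = ≤-trans n≤ (≤-trans (≤-reflexive (arith _ f))
      (+-monoˡ-≤ (f + f) (2+∣p∪q∣≤∣[p∪⁅y⁆]∪[q∪⁅x⁆]∣ (∉-∪ x∉D x∉S) (∉-∪ y∉D y∉S′))))

  stallerWinsS-cap : ∀ {k} → StallerWinsS G k → StallerWinsS G ⌈ n /2⌉
  stallerWinsS-cap {k} = stallerMove-cap k ⌈ n /2⌉ (≤-trans (n≤⌈n/2⌉+⌈n/2⌉ n) (m≤n+m _ ∣ ⊥ {n} ∪ ⊥ ∣))

  stallerWinsD-cap : ∀ {k} → StallerWinsD G k → StallerWinsD G ⌊ n /2⌋
  stallerWinsD-cap     (inj₁ claimed)     = inj₁ claimed
  stallerWinsD-cap {k} (inj₂ (¬dom , next)) =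
    inj₂ (¬dom , λ y free → stallerMove-cap k ⌊ n /2⌋ (n≤ y) (next y free))
    where
    n≤ : ∀ y → n ≤ ∣ (⊥ ∪ ⁅ y ⁆) ∪ ⊥ ∣ + (⌊ n /2⌋ + ⌊ n /2⌋)
    n≤ y = ≤-trans (n≤1+⌊n/2⌋+⌊n/2⌋ n) (+-monoˡ-≤ _ (subst (λ t → suc t ≤ ∣ (⊥ ∪ ⁅ y ⁆) ∪ ⊥ ∣) (∣⊥∣≡0 n)
             (p⊂q⇒∣p∣<∣q∣ ((⊥-elim ∘ ∉⊥) , y , p⊆p∪q ⊥ (x∈p∪⁅x⁆ ⊥ y) , ∉⊥))))

  γ'SMB≤⌈n/2⌉ : ∀ k → Isγ'SMB G k → k ≤ ⌈ n /2⌉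
  γ'SMB≤⌈n/2⌉ k (wins , minimal) = minimal-≤ minimal (stallerWinsS-cap wins)

  γSMB≤⌊n/2⌋ : ∀ k → IsγSMB G k → k ≤ ⌊ n /2⌋
  γSMB≤⌊n/2⌋ k (wins , minimal) = minimal-≤ minimal (stallerWinsD-cap wins)

-- Dominator answers a move on a paired vertex by its partner if that is still
-- free, and plays anywhere otherwise; Reserved vertices are ones he already holds.
module Pairing {n : ℕ} (G : Graph n) (partner : Fin n → Maybe (Fin n))
               (Reserved : Fin n → Set) (B : ℕ) where

  data Guarded (v : Fin n) : Set where
    contains-pair     : ∀ {a b} → partner a ≡ just b → InClosedNbhd G v a → InClosedNbhd G v b → Guarded v
    contains-reserved : ∀ {u} → Reserved u → InClosedNbhd G v u → Guarded v
    exceeds-budget    : (∀ T → (∀ u → InClosedNbhd G v u → u ∈ T) → B < ∣ T ∣) → Guarded v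

  record Position (k : ℕ) (D S : Subset n) : Set where
    field
      disjoint : ∀ {u} → u ∈ D → u ∉ S
      answered : ∀ {a b} → partner a ≡ just b → a ∈ S → b ∈ D
      reserved : ∀ {u} → Reserved u → u ∈ D
      budget   : ∣ S ∣ + k ≤ B
      room     : ∣ D ∣ + ∣ S ∣ + (k + k) < n

  module Strategy (partner-sym    : ∀ {a b} → partner a ≡ just b → partner b ≡ just a)
                  (partner-irrefl : ∀ {a} → partner a ≢ just a)
                  (guarded        : ∀ v → Guarded v) where

    position⇒¬claimed : ∀ {k D S} → Position k D S → ¬ StallerClaimed G S
    position⇒¬claimed {k} {S = S} P (v , claims) = unclaimable (guarded v)
      where
      open Position P
      unclaimable : ¬ Guarded v
      unclaimable (contains-pair a↔b a∈N b∈N) = disjoint (answered a↔b (claims _ a∈N)) (claims _ b∈N)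
      unclaimable (contains-reserved r u∈N)   = disjoint (reserved r) (claims _ u∈N)
      unclaimable (exceeds-budget large)      = <⇒≱ (large S claims) (≤-trans (m≤m+n ∣ S ∣ k) budget)

    Answers : Fin n → Subset n → Fin n → Set
    Answers x D y = ∀ {b} → partner x ≡ just b → b ∈ D ∪ ⁅ y ⁆

    room-for-a-round : ∀ {k D S} → Position (suc k) D S → suc ∣ D ∣ + suc ∣ S ∣ + (k + k) < n
    room-for-a-round {k} {D} {S} P = subst (_< n) (arith ∣ D ∣ ∣ S ∣ k) (Position.room P)
      where
      arith : ∀ a b k → a + b + (suc k + suc k) ≡ suc a + suc b + (k + k)
      arith = solve-∀

    reply-exists : ∀ {k D S x} → Position (suc k) D S → ∃ λ y → Free D (S ∪ ⁅ x ⁆) y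
    reply-exists {k} {D} {S} {x} P with ∣p∣<n⇒∃∉ (D ∪ (S ∪ ⁅ x ⁆)) ∣D∪S′∣<n
      where
      ∣D∪S′∣<n : ∣ D ∪ (S ∪ ⁅ x ⁆) ∣ < n
      ∣D∪S′∣<n = ≤-<-trans (∣p∪q∣≤∣p∣+∣q∣ D _)
                   (≤-<-trans (+-mono-≤ (n≤1+n ∣ D ∣) (∣p∪⁅x⁆∣≤1+∣p∣ S x))
                     (≤-<-trans (m≤m+n _ (k + k)) (room-for-a-round P)))
    ... | y , y∉D∪S′ = y , y∉D∪S′ ∘ p⊆p∪q _ , y∉D∪S′ ∘ q⊆p∪q D _

    answer : ∀ {k D S x} → Position (suc k) D S → Free D S x →
             ∃ λ y → Free D (S ∪ ⁅ x ⁆) y × Answers x D y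
    answer {k} {D} {S} {x} P (x∉D , x∉S) with partner x in x↔
    ... | nothing = let y , free = reply-exists P in y , free , λ ()
    ... | just b with b ∈? D
    ...   | yes b∈D = let y , free = reply-exists P in y , free , λ { refl → p⊆p∪q ⁅ y ⁆ b∈D }
    ...   | no  b∉D = b , (b∉D , ∉-∪⁅⁆ b∉S b≢x) , λ { refl → x∈p∪⁅x⁆ D b }
      where
      b∉S : b ∉ S
      b∉S b∈S = x∉D (Position.answered P (partner-sym x↔) b∈S)
      b≢x : b ≢ x
      b≢x refl = partner-irrefl x↔

    position-step : ∀ {k D S x y} → Position (suc k) D S → Free D S x → Free D (S ∪ ⁅ x ⁆) y →
                    Answers x D y → Position k (D ∪ ⁅ y ⁆) (S ∪ ⁅ x ⁆)
    position-step {k} {D} {S} {x} {y} P (x∉D , _) (_ , y∉S′) answers = record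
      { disjoint = disjoint′
      ; answered = answered′
      ; reserved = p⊆p∪q ⁅ y ⁆ ∘ reserved
      ; budget   = ≤-trans (+-monoˡ-≤ k (∣p∪⁅x⁆∣≤1+∣p∣ S x)) (subst (_≤ B) (+-suc ∣ S ∣ k) budget)
      ; room     = ≤-<-trans (+-monoˡ-≤ (k + k) (+-mono-≤ (∣p∪⁅x⁆∣≤1+∣p∣ D y) (∣p∪⁅x⁆∣≤1+∣p∣ S x)))
                             (room-for-a-round P)
      }
      where
      open Position P
      disjoint′ : ∀ {u} → u ∈ D ∪ ⁅ y ⁆ → u ∉ S ∪ ⁅ x ⁆
      disjoint′ {u} u∈D′ with x∈p∪q⁻ D ⁅ y ⁆ u∈D′
      ... | inj₁ u∈D = ∉-∪⁅⁆ (disjoint u∈D) λ { refl → x∉D u∈D }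
      ... | inj₂ u∈y = subst (_∉ S ∪ ⁅ x ⁆) (sym (x∈⁅y⁆⇒x≡y y u∈y)) y∉S′
      answered′ : ∀ {a b} → partner a ≡ just b → a ∈ S ∪ ⁅ x ⁆ → b ∈ D ∪ ⁅ y ⁆
      answered′ {a} a↔b a∈S′ with x∈p∪q⁻ S ⁅ x ⁆ a∈S′
      ... | inj₁ a∈S = p⊆p∪q ⁅ y ⁆ (answered a↔b a∈S)
      ... | inj₂ a∈x = answers (subst (λ a → partner a ≡ just _) (x∈⁅y⁆⇒x≡y x a∈x) a↔b)

    respond : ∀ {k D S x} → Position (suc k) D S → Free D S x →
              ∃ λ y → Free D (S ∪ ⁅ x ⁆) y × Position k (D ∪ ⁅ y ⁆) (S ∪ ⁅ x ⁆)
    respond P free with answer P free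
    ... | y , free′ , answers = y , free′ , position-step P free free′ answers

    pairing-strategy : ∀ k {D S} → Position k D S → ¬ StallerMove G k D S
    pairing-strategy zero    P claimed        = position⇒¬claimed P claimed
    pairing-strategy (suc k) P (inj₁ claimed) = position⇒¬claimed P claimed
    pairing-strategy (suc k) P (inj₂ (_ , _ , free , continuation)) with respond P free | continuation
    ... | _ , _ , P′     | inj₁ claimed    = position⇒¬claimed P′ claimed
    ... | y , free′ , P′ | inj₂ (_ , next) = pairing-strategy k P′ (next y free′)

data StaircaseVertex (m e : ℕ) : Set where
  q   : StaircaseVertex m e
  c p : Fin m → StaircaseVertex m e
  z   : Fin e → StaircaseVertex m e

module Staircase (m e : ℕ) where

  order : ℕ
  order = e + (suc m + m)

  -- q , c 0 , … , c (m - 1) form one contiguous block, which N[q]-large counts.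
  ⟦_⟧ : StaircaseVertex m e → Fin order
  ⟦ z k ⟧ = k ↑ˡ (suc m + m)
  ⟦ q ⟧   = e ↑ʳ zero
  ⟦ c j ⟧ = e ↑ʳ (suc j ↑ˡ m)
  ⟦ p j ⟧ = e ↑ʳ (suc m ↑ʳ j)

  decodeHub : Fin (suc m) → StaircaseVertex m e
  decodeHub zero    = q
  decodeHub (suc j) = c j

  decode : Fin order → StaircaseVertex m e
  decode u = [ z , [ decodeHub , p ]′ ∘ splitAt (suc m) ]′ (splitAt e u)

  decode-⟦⟧ : ∀ v → decode ⟦ v ⟧ ≡ v
  decode-⟦⟧ (z k) rewrite splitAt-↑ˡ e k (suc m + m) = refl
  decode-⟦⟧ q     rewrite splitAt-↑ʳ e (suc m + m) zero = refl
  decode-⟦⟧ (c j) rewrite splitAt-↑ʳ e (suc m + m) (suc j ↑ˡ m) | splitAt-↑ˡ (suc m) (suc j) m = refl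
  decode-⟦⟧ (p j) rewrite splitAt-↑ʳ e (suc m + m) (suc m ↑ʳ j) | splitAt-↑ʳ (suc m) m j = refl

  ⟦⟧-decode : ∀ u → ⟦ decode u ⟧ ≡ u
  ⟦⟧-decode u with splitAt e u in split₁
  ... | inj₁ k = splitAt⁻¹-↑ˡ split₁
  ... | inj₂ w with splitAt (suc m) w in split₂
  ...   | inj₁ zero    = trans (cong (e ↑ʳ_) (splitAt⁻¹-↑ˡ split₂)) (splitAt⁻¹-↑ʳ split₁)
  ...   | inj₁ (suc j) = trans (cong (e ↑ʳ_) (splitAt⁻¹-↑ˡ split₂)) (splitAt⁻¹-↑ʳ split₁)
  ...   | inj₂ j       = trans (cong (e ↑ʳ_) (splitAt⁻¹-↑ʳ split₂)) (splitAt⁻¹-↑ʳ split₁)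

  ⟦⟧-injective : ∀ {v w} → ⟦ v ⟧ ≡ ⟦ w ⟧ → v ≡ w
  ⟦⟧-injective {v} {w} ⟦v⟧≡⟦w⟧ = trans (sym (decode-⟦⟧ v)) (trans (cong decode ⟦v⟧≡⟦w⟧) (decode-⟦⟧ w))

  ⟦⟧-≢ : ∀ {v w} → v ≢ w → ⟦ v ⟧ ≢ ⟦ w ⟧
  ⟦⟧-≢ v≢w = v≢w ∘ ⟦⟧-injective

  arc : StaircaseVertex m e → StaircaseVertex m e → Bool
  arc q     (c _) = true
  arc (c j) (p i) = ⌊ j ≤ᶠ? i ⌋
  arc _     _     = false

  adjacent : StaircaseVertex m e → StaircaseVertex m e → Bool
  adjacent v w = arc v w ∨ arc w v

  arc-irrefl : ∀ v → arc v v ≡ false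
  arc-irrefl q     = refl
  arc-irrefl (c _) = refl
  arc-irrefl (p _) = refl
  arc-irrefl (z _) = refl

  graph : Graph order
  graph = record
    { adj    = λ u w → adjacent (decode u) (decode w)
    ; sym    = λ u w → ∨-comm (arc (decode u) (decode w)) _
    ; irrefl = λ u → cong (λ b → b ∨ b) (arc-irrefl (decode u))
    }

  p-adjacent-c : ∀ {i j} → j ≤ᶠ i → adjacent (p i) (c j) ≡ true
  p-adjacent-c j≤i = Equivalence.to T-≡ (fromWitness j≤i)

  ClosedNbhd : StaircaseVertex m e → StaircaseVertex m e → Set
  ClosedNbhd v w = w ≡ v ⊎ adjacent v w ≡ true

  closedNbhd⁺ : ∀ v w → ClosedNbhd v w → InClosedNbhd graph ⟦ v ⟧ ⟦ w ⟧
  closedNbhd⁺ v .v (inj₁ refl) = inj₁ refl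
  closedNbhd⁺ v w  (inj₂ v∼w)  =
    inj₂ (subst₂ (λ v′ w′ → adjacent v′ w′ ≡ true) (sym (decode-⟦⟧ v)) (sym (decode-⟦⟧ w)) v∼w)

  closedNbhd-elim : ∀ {v} (P : Fin order → Set) → (∀ {w} → ClosedNbhd v w → P ⟦ w ⟧) →
                    ∀ {u} → InClosedNbhd graph ⟦ v ⟧ u → P u
  closedNbhd-elim {v} P P-nbhd {u} u∈N = subst P (⟦⟧-decode u) (P-nbhd (closedNbhd⁻ u∈N))
    where
    closedNbhd⁻ : InClosedNbhd graph ⟦ v ⟧ u → ClosedNbhd v (decode u)
    closedNbhd⁻ (inj₁ u≡v) = inj₁ (trans (cong decode u≡v) (decode-⟦⟧ v))
    closedNbhd⁻ (inj₂ v∼u) = inj₂ (subst (λ v′ → adjacent v′ (decode u) ≡ true) (decode-⟦⟧ v) v∼u)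

  N[q]⊆ : ∀ (P : Fin order → Set) → P ⟦ q ⟧ → (∀ j → P ⟦ c j ⟧) → ∀ {u} → InClosedNbhd graph ⟦ q ⟧ u → P u
  N[q]⊆ P Pq Pc = closedNbhd-elim P nbhd
    where
    nbhd : ∀ {w} → ClosedNbhd q w → P ⟦ w ⟧
    nbhd {q}   _         = Pq
    nbhd {c j} _         = Pc j
    nbhd {p _} (inj₁ ())
    nbhd {p _} (inj₂ ())
    nbhd {z _} (inj₁ ())
    nbhd {z _} (inj₂ ())

  N[p]⊆ : ∀ (P : Fin order → Set) {i} → P ⟦ p i ⟧ → (∀ j → j ≤ᶠ i → P ⟦ c j ⟧) →
          ∀ {u} → InClosedNbhd graph ⟦ p i ⟧ u → P u
  N[p]⊆ P {i} Pp Pc = closedNbhd-elim P nbhd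
    where
    nbhd : ∀ {w} → ClosedNbhd (p i) w → P ⟦ w ⟧
    nbhd {p _} (inj₁ refl) = Pp
    nbhd {p _} (inj₂ ())
    nbhd {c j} (inj₂ j≤i)  = Pc j (toWitness (Equivalence.from T-≡ j≤i))
    nbhd {c _} (inj₁ ())
    nbhd {q}   (inj₁ ())
    nbhd {q}   (inj₂ ())
    nbhd {z _} (inj₁ ())
    nbhd {z _} (inj₂ ())

  N[z]⊆ : ∀ (P : Fin order → Set) {k} → P ⟦ z k ⟧ → ∀ {u} → InClosedNbhd graph ⟦ z k ⟧ u → P u
  N[z]⊆ P {k} Pz = closedNbhd-elim P nbhd
    where
    nbhd : ∀ {w} → ClosedNbhd (z k) w → P ⟦ w ⟧
    nbhd (inj₁ refl)     = Pz
    nbhd {q}   (inj₂ ())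
    nbhd {c _} (inj₂ ())
    nbhd {p _} (inj₂ ())
    nbhd {z _} (inj₂ ())

  N[q]-large : ∀ T → (∀ u → InClosedNbhd graph ⟦ q ⟧ u → u ∈ T) → m < ∣ T ∣
  N[q]-large T claims = k≤∣p∣-of-block e T λ
    { zero    → claims _ (inj₁ refl)
    ; (suc j) → claims _ (closedNbhd⁺ q (c j) (inj₂ refl))
    }

  partnerᴸ : StaircaseVertex m e → Maybe (Fin order)
  partnerᴸ (c j) = just ⟦ p j ⟧
  partnerᴸ (p j) = just ⟦ c j ⟧
  partnerᴸ _     = nothing

  partner : Fin order → Maybe (Fin order)
  partner = partnerᴸ ∘ decode

  partner-⟦⟧ : ∀ v → partner ⟦ v ⟧ ≡ partnerᴸ v
  partner-⟦⟧ v = cong partnerᴸ (decode-⟦⟧ v)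

  partner-sym : ∀ {a b} → partner a ≡ just b → partner b ≡ just a
  partner-sym {a} a↔b = subst (λ a → partner _ ≡ just a) (⟦⟧-decode a) (partnerᴸ-sym (decode a) a↔b)
    where
    partnerᴸ-sym : ∀ v {b} → partnerᴸ v ≡ just b → partner b ≡ just ⟦ v ⟧
    partnerᴸ-sym (c j) refl = partner-⟦⟧ (p j)
    partnerᴸ-sym (p j) refl = partner-⟦⟧ (c j)

  partner-irrefl : ∀ {a} → partner a ≢ just a
  partner-irrefl {a} a↔a =
    partnerᴸ-irrefl (decode a) (subst (λ a′ → partner a ≡ just a′) (sym (⟦⟧-decode a)) a↔a)
    where
    partnerᴸ-irrefl : ∀ v → partnerᴸ v ≢ just ⟦ v ⟧
    partnerᴸ-irrefl (c j) = ⟦⟧-≢ {p j} {c j} (λ ()) ∘ just-injective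
    partnerᴸ-irrefl (p j) = ⟦⟧-≢ {c j} {p j} (λ ()) ∘ just-injective

  Isolated : Fin order → Set
  Isolated u = ∃ λ k → u ≡ ⟦ z k ⟧

  open Pairing graph partner Isolated m

  guarded : ∀ u → Guarded u
  guarded u = subst Guarded (⟦⟧-decode u) (guardedᴸ (decode u))
    where
    guardedᴸ : ∀ v → Guarded ⟦ v ⟧
    guardedᴸ q     = exceeds-budget N[q]-large
    guardedᴸ (c j) = contains-pair (partner-⟦⟧ (c j)) (inj₁ refl)
                       (closedNbhd⁺ (c j) (p j) (inj₂ (cong (_∨ false) (p-adjacent-c ≤-refl))))
    guardedᴸ (p j) = contains-pair (partner-⟦⟧ (p j)) (inj₁ refl)
                       (closedNbhd⁺ (p j) (c j) (inj₂ (p-adjacent-c ≤-refl)))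
    guardedᴸ (z k) = contains-reserved (k , refl) (inj₁ refl)

  open Strategy partner-sym partner-irrefl guarded public

  opening : ∀ {j D} → j ≤ m → ∣ D ∣ ≤ e → (∀ {u} → Isolated u → u ∈ D) → Position j D ⊥
  opening {j} {D} j≤m ∣D∣≤e isolated∈D = record
    { disjoint = λ _ → ∉⊥
    ; answered = λ _ → ⊥-elim ∘ ∉⊥
    ; reserved = isolated∈D
    ; budget   = subst (λ t → t + j ≤ m) (sym (∣⊥∣≡0 order)) j≤m
    ; room     = subst (λ t → ∣ D ∣ + t + (j + j) < order) (sym (∣⊥∣≡0 order))
                   (≤-<-trans (+-mono-≤ (≤-trans (≤-reflexive (+-identityʳ ∣ D ∣)) ∣D∣≤e) (+-mono-≤ j≤m j≤m))
                              (+-monoʳ-< e (n<1+n (m + m))))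
    }

  open Game graph public

  record Climb (i : ℕ) (D S : Subset order) : Set where
    field
      c-claimed     : ∀ j → toℕ j < i → ⟦ c j ⟧ ∈ S
      c-undominated : ∀ j → ⟦ c j ⟧ ∉ D
      c-unclaimed   : ∀ j → i ≤ toℕ j → ⟦ c j ⟧ ∉ S
      p-free        : ∀ j → i ≤ toℕ j → Free D S ⟦ p j ⟧
      q-free        : Free D S ⟦ q ⟧

  q-undominated : ∀ {i D S} → Climb i D S → Undominated D ⟦ q ⟧
  q-undominated {D = D} C = N[q]⊆ (_∉ D) (proj₁ (Climb.q-free C)) (Climb.c-undominated C)

  climb-start : ∀ {D} → (∀ v → ⟦ v ⟧ ∈ D → ∃ λ k → v ≡ z k) → Climb 0 D ⊥
  climb-start only-isolated = record
    { c-claimed     = λ _ ()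
    ; c-undominated = λ j cj∈D → case only-isolated (c j) cj∈D of λ { (_ , ()) }
    ; c-unclaimed   = λ _ _ → ∉⊥
    ; p-free        = λ j _ → (λ pj∈D → case only-isolated (p j) pj∈D of λ { (_ , ()) }) , ∉⊥
    ; q-free        = (λ q∈D → case only-isolated q q∈D of λ { (_ , ()) }) , ∉⊥
    }

  climb : ∀ r i {D S} → i + r ≡ m → Climb i D S → StallerMove graph (suc r) D S
  climb zero i {D} {S} i+0≡m C = staller-completes ⟦ q ⟧ q-free (q-undominated C) λ _ →
    N[q]⊆ (_∈ S ∪ ⁅ ⟦ q ⟧ ⁆) (x∈p∪⁅x⁆ S _) λ j →
      p⊆p∪q _ (c-claimed j (subst (toℕ j <_) (trans (sym i+0≡m) (+-identityʳ i)) (toℕ<n j)))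
    where open Climb C
  climb (suc r) i {D} {S} i+1+r≡m C =
    staller-threatens (c-undominated I , c-unclaimed I i≤I) (q-undominated C) reply
    where
    open Climb C
    i<m : i < m
    i<m = subst (i <_) i+1+r≡m (m<m+n i z<s)
    I : Fin m
    I = fromℕ< i<m
    I≡i : toℕ I ≡ i
    I≡i = toℕ-fromℕ< i<m
    i≤I : i ≤ toℕ I
    i≤I = ≤-reflexive (sym I≡i)
    x : Fin order
    x = ⟦ c I ⟧
    c-claimed′ : ∀ j → j ≤ᶠ I → ⟦ c j ⟧ ∈ S ∪ ⁅ x ⁆
    c-claimed′ j j≤I with m≤n⇒m<n∨m≡n j≤I
    ... | inj₁ j<I = p⊆p∪q _ (c-claimed j (subst (toℕ j <_) I≡i j<I))
    ... | inj₂ j≡I = subst (λ j → ⟦ c j ⟧ ∈ S ∪ ⁅ x ⁆) (sym (toℕ-injective j≡I)) (x∈p∪⁅x⁆ S x)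
    climbed : Climb (suc i) (D ∪ ⁅ ⟦ p I ⟧ ⁆) (S ∪ ⁅ x ⁆)
    climbed = record
      { c-claimed     = λ j j<1+i → c-claimed′ j (subst (toℕ j ≤_) (sym I≡i) (s≤s⁻¹ j<1+i))
      ; c-undominated = λ j → ∉-∪⁅⁆ (c-undominated j) (⟦⟧-≢ {c j} {p I} λ ())
      ; c-unclaimed   = λ j i<j → ∉-∪⁅⁆ (c-unclaimed j (<⇒≤ i<j))
                                        (⟦⟧-≢ {c j} {c I} λ { refl → <⇒≢ i<j (sym I≡i) })
      ; p-free        = λ j i<j → ∉-∪⁅⁆ (proj₁ (p-free j (<⇒≤ i<j)))
                                        (⟦⟧-≢ {p j} {p I} λ { refl → <⇒≢ i<j (sym I≡i) })
                                , ∉-∪⁅⁆ (proj₂ (p-free j (<⇒≤ i<j))) (⟦⟧-≢ {p j} {c I} λ ())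
      ; q-free        = ∉-∪⁅⁆ (proj₁ q-free) (⟦⟧-≢ {q} {p I} λ ())
                      , ∉-∪⁅⁆ (proj₂ q-free) (⟦⟧-≢ {q} {c I} λ ())
      }
    reply : ∀ y → Free D (S ∪ ⁅ x ⁆) y → StallerMove graph (suc r) (D ∪ ⁅ y ⁆) (S ∪ ⁅ x ⁆)
    reply y (y∉D , y∉S′) with y ≟ᶠ ⟦ p I ⟧
    ... | yes refl = climb r (suc i) (trans (sym (+-suc i r)) i+1+r≡m) climbed
    ... | no  y≢pI = staller-completes ⟦ p I ⟧ pI-free pI-undominated λ _ →
                       N[p]⊆ (_∈ (S ∪ ⁅ x ⁆) ∪ ⁅ ⟦ p I ⟧ ⁆) (x∈p∪⁅x⁆ _ _) λ j j≤I → p⊆p∪q _ (c-claimed′ j j≤I)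
      where
      pI-free : Free (D ∪ ⁅ y ⁆) (S ∪ ⁅ x ⁆) ⟦ p I ⟧
      pI-free = ∉-∪⁅⁆ (proj₁ (p-free I i≤I)) (y≢pI ∘ sym)
              , ∉-∪⁅⁆ (proj₂ (p-free I i≤I)) (⟦⟧-≢ {p I} {c I} λ ())
      pI-undominated : Undominated (D ∪ ⁅ y ⁆) ⟦ p I ⟧
      pI-undominated = N[p]⊆ (_∉ D ∪ ⁅ y ⁆) (proj₁ pI-free) λ j j≤I →
        ∉-∪⁅⁆ (c-undominated j) λ cj≡y → y∉S′ (subst (_∈ S ∪ ⁅ x ⁆) cj≡y (c-claimed′ j j≤I))

staircase-γ'SMB : ∀ m → Isγ'SMB (Staircase.graph m 0) (suc m)
staircase-γ'SMB m = climb m 0 refl (climb-start λ _ → ⊥-elim ∘ ∉⊥) , minimal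
  where
  open Staircase m 0
  minimal : ∀ j → j < suc m → ¬ StallerWinsS graph j
  minimal j j<1+m = pairing-strategy j (opening (s≤s⁻¹ j<1+m) (≤-reflexive (∣⊥∣≡0 order)) λ { (() , _) })

staircase-γSMB : ∀ m → IsγSMB (Staircase.graph m 1) (suc m)
staircase-γSMB m = inj₂ (undominated⇒¬dominates {v = ⟦ q ⟧} (λ _ → ∉⊥) , first-reply) , minimal
  where
  open Staircase m 1
  z₀ : Fin order
  z₀ = ⟦ z zero ⟧
  first-reply : ∀ (y : Fin order) → Free ⊥ ⊥ y → StallerMove graph (suc m) (⊥ ∪ ⁅ y ⁆) ⊥
  first-reply y _ with y ≟ᶠ z₀
  ... | yes refl = climb m 0 refl (climb-start only-z₀)
    where
    only-z₀ : ∀ v → ⟦ v ⟧ ∈ ⊥ ∪ ⁅ z₀ ⁆ → ∃ λ k → v ≡ z k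
    only-z₀ v v∈D =
      [ ⊥-elim ∘ ∉⊥ , (λ v∈⁅z₀⁆ → zero , ⟦⟧-injective (x∈⁅y⁆⇒x≡y z₀ v∈⁅z₀⁆)) ]′ (x∈p∪q⁻ ⊥ _ v∈D)
  ... | no  y≢z₀ = staller-completes z₀ (z₀∉D , ∉⊥) (N[z]⊆ (_∉ ⊥ ∪ ⁅ y ⁆) z₀∉D) λ _ →
                     N[z]⊆ (_∈ ⊥ ∪ ⁅ z₀ ⁆) (x∈p∪⁅x⁆ ⊥ z₀)
    where
    z₀∉D : z₀ ∉ ⊥ ∪ ⁅ y ⁆
    z₀∉D = ∉-∪⁅⁆ ∉⊥ (y≢z₀ ∘ sym)
  minimal : ∀ j → j < suc m → ¬ StallerWinsD graph j
  minimal j _     (inj₁ (v , claims)) = ∉⊥ (claims v (inj₁ refl))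
  minimal j j<1+m (inj₂ (_ , next))   =
    pairing-strategy j (opening (s≤s⁻¹ j<1+m) ∣D∣≤1 λ { (zero , refl) → x∈p∪⁅x⁆ ⊥ z₀ }) (next z₀ (∉⊥ , ∉⊥))
    where
    ∣D∣≤1 : ∣ ⊥ ∪ ⁅ z₀ ⁆ ∣ ≤ 1
    ∣D∣≤1 = ≤-trans (∣p∪⁅x⁆∣≤1+∣p∣ ⊥ z₀) (s≤s (≤-reflexive (∣⊥∣≡0 order)))

proposition7p1 :
    ((n : ℕ) (G : Graph n) (k : ℕ) → Isγ'SMB G k → k ≤ ⌈ n /2⌉)
    × ((n : ℕ) (G : Graph n) (k : ℕ) → IsγSMB G k → k ≤ ⌊ n /2⌋)
    × ((m : ℕ) → ∃ λ n → n ≥ m × Σ (Graph n) λ G → Isγ'SMB G ⌈ n /2⌉)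
    × ((m : ℕ) → ∃ λ n → n ≥ m × Σ (Graph n) λ G → IsγSMB G ⌊ n /2⌋)
proposition7p1 = (λ n G → Game.γ'SMB≤⌈n/2⌉ G)
  , (λ n G → Game.γSMB≤⌊n/2⌋ G)
  , (λ m → suc (m + m) , ≤-trans (m≤m+n m m) (n≤1+n _) , Staircase.graph m 0
         , subst (Isγ'SMB (Staircase.graph m 0) ∘ suc) (n≡⌊n+n/2⌋ m) (staircase-γ'SMB m))
  , (λ m → 2 + (m + m) , ≤-trans (m≤m+n m m) (≤-trans (n≤1+n _) (n≤1+n _)) , Staircase.graph m 1
         , subst (IsγSMB (Staircase.graph m 1) ∘ suc) (n≡⌊n+n/2⌋ m) (staircase-γSMB m))
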